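{- Let $\Theta=\{A_1\leftarrow t_1,\ldots,A_\alpha\leftarrow t_\alpha\}$ be a standard s-substitution and $p$ a state over the parameters of $\Theta$. Then $\psi_p(\Theta)=\{\psi_p(A_1)\leftarrow\psi_p(t_1),\ldots,\psi_p(A_\alpha)\leftarrow\psi_p(t_\alpha)\}$ is an extended s-substitution, and for all parameter assignments $\sigma\in\mathcal S(p)$ we have $\Theta[\sigma]=\psi_p(\Theta)[\sigma]$.
   Context: Parameters range over natural numbers; numerals are $\bar0,\bar1=s(\bar0),\bar2,\ldots$; a parameter assignment $\sigma$ maps parameters to numerals and evaluates terms built from $\bar0$, parameters, $s$ and $p$ (predecessor, $p(\bar0)=\bar0$) to numerals. For $k\ge1$, a $k$-ary variable class $X$ is a set of first-order variables $X(\nu_1,\ldots,\nu_k)$ indexed bijectively by $k$-tuples of numerals (distinct classes disjoint); $X(r_1,\ldots,r_k)$ with numeric terms $r_i$ is a variable expression, $\sigma(X(r_1,\ldots,r_k)){\downarrow}=X(\sigma(r_1){\downarrow},\ldots,\sigma(r_k){\downarrow})$. Schematic individual terms are built from constants, variables, variable expressions, first-order function symbols and primitive-recursively defined schematic term symbols $\hat t(s_1,\ldots,s_i,r_1,\ldots,r_j)$; $\sigma(t){\downarrow}$ is the first-order term obtained by evaluating under $\sigma$ and unfolding definitions. Each variable class $X$ of arity $k$ has a fixed parameter list $(m_1,\ldots,m_k)$; $X(r_1,\ldots,r_k)$ is standard if each $r_i\in\{m_i,\bar0,p(m_i),s(m_i)\}$; a standard term has only standard variable expressions. Two variable expressions are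 parameter-unifiable if some $\sigma$ evaluates them to the same variable. A standard s-substitution is $\{A_1\leftarrow t_1,\ldots,A_\alpha\leftarrow t_\alpha\}$ with $A_i$ standard variable expressions, $t_i$ standard terms and $A_i,A_j$ not parameter-unifiable for $i\neq j$. An extended s-substitution is $\{V_1\leftarrow t_1,\ldots\}$ with variable expressions $V_i$ and schematic terms $t_i$ (possibly containing variable expressions) such that $\sigma(V_i){\downarrow}\neq\sigma(V_j){\downarrow}$ for all $\sigma$ and $i\neq j$. For either kind, $\Theta[\sigma]=\{\sigma(V_i){\downarrow}\leftarrow\sigma(t_i){\downarrow}\}_i$. A state over a finite parameter set $\mathcal P$ is a conjunction choosing for each $m\in\mathcal P$ one of: $m=\bar0$; $m\neq\bar0\wedge p(m)=\bar0$; $m\neq\bar0\wedge p(m)\neq\bar0$; $\mathcal S(p)$ is the set of assignments satisfying $p$. $\psi_p$ on a standard variable expression $X(r_1,\ldots,r_k)$ with list $(m_1,\ldots,m_k)$: for each $i$, if $p$ contains $m_i=\bar0$, replace $r_i\in\{m_i,p(m_i),\bar0\}$ by $\bar0$ and $s(m_i)$ by $\bar1$; if $p$ contains $m_i\neq\bar0\wedge p(m_i)=\bar0$, replace $p(m_i)$ by $\bar0$, $m_i$ by $\bar1$, $s(m_i)$ by $\bar2$, leave $\bar0$; otherwise leave $r_i$. $\psi_p$ fixes constants and ordinary variables and is homomorphic over function symbols and individual arguments of schematic symbols (numeric arguments unchanged). -}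

module Defs where

open import Data.Nat using (ℕ; zero; suc; pred; _≤_; _≟_)
open import Data.Bool using (Bool; true; false; if_then_else_)
open import Data.Product using (Σ; _×_; _,_; proj₁; proj₂)
open import Data.List using (List; []; _∷_; _++_)
import Data.List as L
import Data.List.Relation.Unary.All as LA
open import Data.List.Membership.Propositional using (_∈_)
open import Data.List.Relation.Unary.AllPairs using (AllPairs)
open import Data.Vec using (Vec; []; _∷_; zipWith)
import Data.Vec as V
open import Data.Vec.Relation.Unary.All using (All)
open import Data.Vec.Relation.Binary.Pointwise.Inductive using (Pointwise)
open import Relation.Nullary using (¬_; does)
open import Relation.Binary.PropositionalEquality using (_≡_; _≢_)

-- Numeric terms: built from 0̄, parameters (named by ℕ), s and p.
-- Numerals ν̄ are represented by natural numbers ν.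

data NTerm : Set where
  zero' : NTerm
  par   : ℕ → NTerm
  s     : NTerm → NTerm
  p     : NTerm → NTerm

Assignment : Set
Assignment = ℕ → ℕ

evalN : Assignment → NTerm → ℕ
evalN σ zero'   = zero
evalN σ (par m) = σ m
evalN σ (s r)   = suc (evalN σ r)
evalN σ (p r)   = pred (evalN σ r)

-- Signature: variable classes (named by ℕ) with arity ≥ 1 and fixed
-- parameter lists; first-order function symbols; schematic term symbols
-- with i individual and j numeric arguments.  Constants and ordinary
-- variables are named by ℕ.

record Sig : Set where
  field
    varity     : ℕ → ℕ
    varity-pos : ∀ X → 1 ≤ varity X
    plist      : (X : ℕ) → Vec ℕ (varity X)
    farity     : ℕ → ℕ
    iarity     : ℕ → ℕ
    jarity     : ℕ → ℕ

module _ (S : Sig) where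
  open Sig S

  data FOVar : Set where
    ord : ℕ → FOVar
    cls : (X : ℕ) → Vec ℕ (varity X) → FOVar

  data FTerm : Set where
    cst : ℕ → FTerm
    var : FOVar → FTerm
    fun : (f : ℕ) → Vec FTerm (farity f) → FTerm

  VExp : Set
  VExp = Σ ℕ (λ X → Vec NTerm (varity X))

  data STerm : Set where
    cst  : ℕ → STerm
    var  : ℕ → STerm
    vexp : (X : ℕ) → Vec NTerm (varity X) → STerm
    fun  : (f : ℕ) → Vec STerm (farity f) → STerm
    sch  : (h : ℕ) → Vec STerm (iarity h) → Vec NTerm (jarity h) → STerm

  -- The (primitive recursive) defining equations of the schematic term
  -- symbols, given by their unfolding: for numerals for the numeric
  -- arguments and first-order terms for the individual arguments, the
  -- first-order term obtained by unfolding the definition.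
  SchDefs : Set
  SchDefs = (h : ℕ) → Vec FTerm (iarity h) → Vec ℕ (jarity h) → FTerm

  evalV : Assignment → VExp → FOVar
  evalV σ (X , rs) = cls X (V.map (evalN σ) rs)

  mutual
    evalT : SchDefs → Assignment → STerm → FTerm
    evalT D σ (cst c)      = cst c
    evalT D σ (var x)      = var (ord x)
    evalT D σ (vexp X rs)  = var (evalV σ (X , rs))
    evalT D σ (fun f ts)   = fun f (evalTs D σ ts)
    evalT D σ (sch h ts ns) = D h (evalTs D σ ts) (V.map (evalN σ) ns)

    evalTs : ∀ {n} → SchDefs → Assignment → Vec STerm n → Vec FTerm n
    evalTs D σ []       = []
    evalTs D σ (t ∷ ts) = evalT D σ t ∷ evalTs D σ ts

  data StdArg (m : ℕ) : NTerm → Set where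
    a-m : StdArg m (par m)
    a-0 : StdArg m zero'
    a-p : StdArg m (p (par m))
    a-s : StdArg m (s (par m))

  StdVExp : VExp → Set
  StdVExp (X , rs) = Pointwise StdArg (plist X) rs

  data StdTerm : STerm → Set where
    cst  : ∀ c → StdTerm (cst c)
    var  : ∀ x → StdTerm (var x)
    vexp : ∀ X rs → StdVExp (X , rs) → StdTerm (vexp X rs)
    fun  : ∀ f ts → All StdTerm ts → StdTerm (fun f ts)
    sch  : ∀ h ts ns → All StdTerm ts → StdTerm (sch h ts ns)

  ParUnifiable : VExp → VExp → Set
  ParUnifiable V W = Σ Assignment (λ σ → evalV σ V ≡ evalV σ W)

  Subst : Set
  Subst = List (VExp × STerm)

  StdSubst : Subst → Set
  StdSubst Θ =
    LA.All (λ b → StdVExp (proj₁ b) × StdTerm (proj₂ b)) Θ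
    × AllPairs (λ a b → ¬ ParUnifiable (proj₁ a) (proj₁ b)) Θ

  ExtSubst : Subst → Set
  ExtSubst Θ =
    AllPairs (λ a b → (σ : Assignment) → evalV σ (proj₁ a) ≢ evalV σ (proj₁ b)) Θ

  inst : SchDefs → Assignment → Subst → List (FOVar × FTerm)
  inst D σ Θ = L.map (λ b → evalV σ (proj₁ b) , evalT D σ (proj₂ b)) Θ

  paramsN : NTerm → List ℕ
  paramsN zero'   = []
  paramsN (par m) = m ∷ []
  paramsN (s r)   = paramsN r
  paramsN (p r)   = paramsN r

  paramsNs : ∀ {n} → Vec NTerm n → List ℕ
  paramsNs []       = []
  paramsNs (r ∷ rs) = paramsN r ++ paramsNs rs

  mutual
    paramsT : STerm → List ℕ
    paramsT (cst c)       = []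
    paramsT (var x)       = []
    paramsT (vexp X rs)   = paramsNs rs
    paramsT (fun f ts)    = paramsTs ts
    paramsT (sch h ts ns) = paramsTs ts ++ paramsNs ns

    paramsTs : ∀ {n} → Vec STerm n → List ℕ
    paramsTs []       = []
    paramsTs (t ∷ ts) = paramsT t ++ paramsTs ts

  paramsSub : Subst → List ℕ
  paramsSub []             = []
  paramsSub ((V , t) ∷ Θ) = paramsNs (proj₂ V) ++ paramsT t ++ paramsSub Θ

data Case : Set where
  isZero : Case
  isOne  : Case
  geTwo  : Case

Sat : ℕ → Case → Set
Sat n isZero = n ≡ zero
Sat n isOne  = (n ≢ zero) × (pred n ≡ zero)
Sat n geTwo  = (n ≢ zero) × (pred n ≢ zero)

-- a state over P: a choice of Case for each parameter (only the values
-- on P are relevant)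
State : Set
State = ℕ → Case

InS : List ℕ → State → Assignment → Set
InS P st σ = ∀ m → m ∈ P → Sat (σ m) (st m)

isParM : ℕ → NTerm → Bool
isParM m (par n) = does (n ≟ m)
isParM m _       = false

psiArg : Case → ℕ → NTerm → NTerm
psiArg isZero m zero'   = zero'
psiArg isZero m (par n) = if does (n ≟ m) then zero' else par n
psiArg isZero m (p r)   = if isParM m r then zero' else p r
psiArg isZero m (s r)   = if isParM m r then s zero' else s r
psiArg isOne  m zero'   = zero'
psiArg isOne  m (par n) = if does (n ≟ m) then s zero' else par n
psiArg isOne  m (p r)   = if isParM m r then zero' else p r
psiArg isOne  m (s r)   = if isParM m r then s (s zero') else s r
psiArg geTwo  m r       = r

module _ (S : Sig) (st : State) where
  open Sig S

  psiV : VExp S → VExp S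
  psiV (X , rs) = X , zipWith (λ m r → psiArg (st m) m r) (plist X) rs

  mutual
    psiT : STerm S → STerm S
    psiT (cst c)       = cst c
    psiT (var x)       = var x
    psiT (vexp X rs)   = vexp X (proj₂ (psiV (X , rs)))
    psiT (fun f ts)    = fun f (psiTs ts)
    psiT (sch h ts ns) = sch h (psiTs ts) ns

    psiTs : ∀ {n} → Vec (STerm S) n → Vec (STerm S) n
    psiTs []       = []
    psiTs (t ∷ ts) = psiT t ∷ psiTs ts

  psiSub : Subst S → Subst S
  psiSub = L.map (λ b → psiV (proj₁ b) , psiT (proj₂ b))

-- ψ_p only rewrites an argument of a standard variable expression whose
-- list parameter m is fixed by p to 0̄ or 1̄, and then it merely replaces m
-- by that value.  Hence evaluating ψ_p(A) under σ is evaluating A under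
-- the assignment σ clamped to the values p prescribes.  For σ ∈ 𝒮(p)
-- clamping changes nothing, so Θ[σ] = ψ_p(Θ)[σ]; and a common instance of
-- ψ_p(A_i) and ψ_p(A_j) under σ is a common instance of A_i and A_j under
-- the clamped σ, which standardness of Θ excludes.
module Submission where

open import Defs
open import Data.Product using (_×_; _,_; proj₁; proj₂)
open import Data.Nat using (ℕ; zero; suc; pred; _≟_)
open import Data.List using ([]; _∷_; _++_)
import Data.List.Relation.Unary.All as LA
open import Data.List.Relation.Unary.AllPairs using (AllPairs; []; _∷_)
import Data.List.Relation.Unary.AllPairs.Properties as AllPairs
open import Data.List.Relation.Unary.Any using (here)
open import Data.List.Membership.Propositional using (_∈_)
open import Data.List.Membership.Propositional.Properties using (∈-++⁺ˡ; ∈-++⁺ʳ)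
open import Data.Vec using (Vec; []; _∷_; zipWith)
import Data.Vec as V
open import Data.Vec.Relation.Unary.All using (All; []; _∷_)
open import Data.Vec.Relation.Binary.Pointwise.Inductive using (Pointwise; []; _∷_)
open import Relation.Nullary using (¬_)
open import Relation.Nullary.Decidable using (dec-true)
open import Relation.Binary.PropositionalEquality
  using (_≡_; _≢_; refl; sym; trans; cong; cong₂)
open import Data.Empty using (⊥-elim)

AllPairs-mapUnderAll : {A : Set} {P : A → Set} {R Q : A → A → Set} →
                       (∀ {x y} → P x → P y → R x y → Q x y) →
                       ∀ {xs} → LA.All P xs → AllPairs R xs → AllPairs Q xs
AllPairs-mapUnderAll f LA.[] [] = []
AllPairs-mapUnderAll f (px LA.∷ pxs) (rxs ∷ rs) =
  LA.zipWith (λ (py , rxy) → f px py rxy) (pxs , rxs) ∷ AllPairs-mapUnderAll f pxs rs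

InS-++ˡ : ∀ {xs ys st σ} → InS (xs ++ ys) st σ → InS xs st σ
InS-++ˡ h m m∈xs = h m (∈-++⁺ˡ m∈xs)

InS-++ʳ : ∀ xs {ys st σ} → InS (xs ++ ys) st σ → InS ys st σ
InS-++ʳ xs h m m∈ys = h m (∈-++⁺ʳ xs m∈ys)

clampCase : Case → ℕ → ℕ
clampCase isZero _ = 0
clampCase isOne  _ = 1
clampCase geTwo  n = n

clamp : State → Assignment → Assignment
clamp st σ m = clampCase (st m) (σ m)

clampCase-Sat : ∀ {n} c → Sat n c → clampCase c n ≡ n
clampCase-Sat isZero n≡0             = sym n≡0
clampCase-Sat {zero}  isOne (n≢0 , _) = ⊥-elim (n≢0 refl)
clampCase-Sat {suc n} isOne (_ , n≡0) = cong suc (sym n≡0)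
clampCase-Sat geTwo _                = refl

clamp-InS : ∀ {P st σ} → InS P st σ → ∀ m → m ∈ P → clamp st σ m ≡ σ m
clamp-InS {st = st} h m m∈P = clampCase-Sat (st m) (h m m∈P)

module _ (S : Sig) where
  open Sig S

  evalN-cong : ∀ {σ τ} r → (∀ m → m ∈ paramsN S r → σ m ≡ τ m) →
               evalN σ r ≡ evalN τ r
  evalN-cong zero'   _  = refl
  evalN-cong (par m) eq = eq m (here refl)
  evalN-cong (s r)   eq = cong suc (evalN-cong r eq)
  evalN-cong (p r)   eq = cong pred (evalN-cong r eq)

  evalNs-cong : ∀ {n σ τ} (rs : Vec NTerm n) → (∀ m → m ∈ paramsNs S rs → σ m ≡ τ m) →
                V.map (evalN σ) rs ≡ V.map (evalN τ) rs
  evalNs-cong []       _  = refl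
  evalNs-cong (r ∷ rs) eq =
    cong₂ _∷_ (evalN-cong r (λ m i → eq m (∈-++⁺ˡ i)))
              (evalNs-cong rs (λ m i → eq m (∈-++⁺ʳ (paramsN S r) i)))

  module _ (st : State) where

    evalN-psiArg : ∀ σ {m r} → StdArg S m r →
                   evalN σ (psiArg (st m) m r) ≡ evalN (clamp st σ) r
    evalN-psiArg σ {m} a-0 with st m
    ... | isZero = refl
    ... | isOne  = refl
    ... | geTwo  = refl
    evalN-psiArg σ {m} a-m with st m | dec-true (m ≟ m) refl
    ... | isZero | m≟m rewrite m≟m = refl
    ... | isOne  | m≟m rewrite m≟m = refl
    ... | geTwo  | _ = refl
    evalN-psiArg σ {m} a-p with st m | dec-true (m ≟ m) refl
    ... | isZero | m≟m rewrite m≟m = refl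
    ... | isOne  | m≟m rewrite m≟m = refl
    ... | geTwo  | _ = refl
    evalN-psiArg σ {m} a-s with st m | dec-true (m ≟ m) refl
    ... | isZero | m≟m rewrite m≟m = refl
    ... | isOne  | m≟m rewrite m≟m = refl
    ... | geTwo  | _ = refl

    evalV-psiV : ∀ σ V → StdVExp S V → evalV S σ (psiV S st V) ≡ evalV S (clamp st σ) V
    evalV-psiV σ (X , rs) std = cong (cls X) (evalArgs std)
      where
      evalArgs : ∀ {n} {ms : Vec ℕ n} {rs : Vec NTerm n} → Pointwise (StdArg S) ms rs →
                 V.map (evalN σ) (zipWith (λ m r → psiArg (st m) m r) ms rs)
                   ≡ V.map (evalN (clamp st σ)) rs
      evalArgs []           = refl
      evalArgs (std ∷ stds) = cong₂ _∷_ (evalN-psiArg σ std) (evalArgs stds)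

    psiV-separates : ∀ {V W} → StdVExp S V → StdVExp S W → ¬ ParUnifiable S V W →
                     ∀ σ → evalV S σ (psiV S st V) ≢ evalV S σ (psiV S st W)
    psiV-separates {V} {W} stdV stdW nonunif σ eq =
      nonunif (clamp st σ , trans (sym (evalV-psiV σ V stdV)) (trans eq (evalV-psiV σ W stdW)))

    psiSub-ExtSubst : ∀ Θ → StdSubst S Θ → ExtSubst S (psiSub S st Θ)
    psiSub-ExtSubst Θ (stds , nonunif) =
      AllPairs.map⁺ (AllPairs-mapUnderAll psiV-separates (LA.map proj₁ stds) nonunif)

    module _ (D : SchDefs S) (σ : Assignment) where

      evalV-psiV-InS : ∀ V → StdVExp S V → InS (paramsNs S (proj₂ V)) st σ →
                       evalV S σ (psiV S st V) ≡ evalV S σ V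
      evalV-psiV-InS V@(X , rs) std h = trans (evalV-psiV σ V std)
                                              (cong (cls X) (evalNs-cong rs (clamp-InS h)))

      mutual
        evalT-psiT : ∀ {t} → StdTerm S t → InS (paramsT S t) st σ →
                     evalT S D σ (psiT S st t) ≡ evalT S D σ t
        evalT-psiT (cst c)          _ = refl
        evalT-psiT (var x)          _ = refl
        evalT-psiT (vexp X rs std)  h = cong var (evalV-psiV-InS (X , rs) std h)
        evalT-psiT (fun f ts stds)  h = cong (fun f) (evalTs-psiTs stds h)
        evalT-psiT (sch g ts ns stds) h =
          cong (λ us → D g us (V.map (evalN σ) ns)) (evalTs-psiTs stds (InS-++ˡ h))

        evalTs-psiTs : ∀ {n} {ts : Vec (STerm S) n} → All (StdTerm S) ts →
                       InS (paramsTs S ts) st σ →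
                       evalTs S D σ (psiTs S st ts) ≡ evalTs S D σ ts
        evalTs-psiTs []                        _ = refl
        evalTs-psiTs {ts = t ∷ _} (std ∷ stds) h =
          cong₂ _∷_ (evalT-psiT std (InS-++ˡ h)) (evalTs-psiTs stds (InS-++ʳ (paramsT S t) h))

      inst-psiSub : ∀ Θ → LA.All (λ b → StdVExp S (proj₁ b) × StdTerm S (proj₂ b)) Θ →
                    InS (paramsSub S Θ) st σ → inst S D σ (psiSub S st Θ) ≡ inst S D σ Θ
      inst-psiSub [] _ _ = refl
      inst-psiSub ((V , t) ∷ Θ) ((stdV , stdt) LA.∷ stds) h =
        cong₂ _∷_ (cong₂ _,_ (evalV-psiV-InS V stdV (InS-++ˡ h))
                             (evalT-psiT stdt (InS-++ˡ h′)))
                  (inst-psiSub Θ stds (InS-++ʳ (paramsT S t) h′))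
        where h′ = InS-++ʳ (paramsNs S (proj₂ V)) h

proposition3 : (S : Sig) (D : SchDefs S) (Θ : Subst S) → StdSubst S Θ →
               (st : State) →
               ExtSubst S (psiSub S st Θ)
               × ((σ : Assignment) → InS (paramsSub S Θ) st σ →
                  inst S D σ Θ ≡ inst S D σ (psiSub S st Θ))
proposition3 S D Θ stdΘ st =
  psiSub-ExtSubst S st Θ stdΘ ,
  λ σ σ∈𝒮p → sym (inst-psiSub S st D σ Θ (proj₁ stdΘ) σ∈𝒮p)
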